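{- For integers $N,p,r,x$ for which all expressions below are defined (all denominators nonzero), the Hahn polynomials satisfy $$H_r(x,N,p)=\frac{N}{p}\left(\frac{p-r}{N-2r}\,H_r(x,N-1,p-1)+\frac{N-p-r+1}{N-2r+2}\,H_{r-1}(x,N-1,p-1)\right).$$
   Context: Binomial coefficients are generalized: $\binom{a}{b}=a(a-1)\cdots(a-b+1)/b!$ for integers $b\ge 0$ and $\binom{a}{b}=0$ for $b<0$. The Eberlein polynomial is $E_i(x,N,p)=\sum_{\ell=0}^i(-1)^\ell\binom{x}{\ell}\binom{p-x}{i-\ell}\binom{N-p-x}{i-\ell}$, which also equals $\sum_{\ell=0}^{i}(-1)^{i+\ell}\binom{p-\ell}{p-i}\binom{p-x}{\ell}\binom{N-p-x+\ell}{\ell}$. The Hahn polynomial is $H_i(x,N,p)=\frac{\binom{N}{i}-\binom{N}{i-1}}{\binom{p}{x}\binom{N-p}{x}}\,E_x(i,N,p)$. -}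

module Defs where

open import Data.Nat as ℕ using (ℕ; zero; suc)

open import Data.Integer as ℤ using (ℤ; +_; -[1+_])
open import Data.Rational as ℚ using (ℚ; 0ℚ; 1ℚ; _+_; _*_; _-_; -_; 1/_; ≢-nonZero)
open import Data.Rational.Properties using (_≟_)
open import Data.List using (List; map; foldr; upTo)
open import Relation.Nullary using (yes; no)

⟦_⟧ : ℤ → ℚ
⟦ z ⟧ = z ℚ./ 1

-- total inverse on ℚ (0 ↦ 0); only ever applied to quantities assumed nonzero
inv : ℚ → ℚ
inv q with q ≟ 0ℚ
... | yes _ = 0ℚ
... | no q≢0 = 1/_ q {{≢-nonZero q≢0}}

_÷_ : ℚ → ℚ → ℚ
a ÷ b = a * inv b

sumℚ : List ℚ → ℚ
sumℚ = foldr _+_ 0ℚ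

fall : ℤ → ℕ → ℚ
fall a zero    = 1ℚ
fall a (suc b) = fall a b * ⟦ a ℤ.- + b ⟧

binom : ℤ → ℤ → ℚ
binom a (+ b)    = fall a b ÷ ⟦ + (b ℕ.!) ⟧
binom a -[1+ _ ] = 0ℚ

sgn : ℕ → ℚ
sgn zero    = 1ℚ
sgn (suc n) = - sgn n

Eberlein : ℤ → ℤ → ℤ → ℤ → ℚ
Eberlein (+ i) x N p =
  sumℚ (map (λ ℓ → sgn ℓ * binom x (+ ℓ) * binom (p ℤ.- x) (+ i ℤ.- + ℓ)
                         * binom (N ℤ.- p ℤ.- x) (+ i ℤ.- + ℓ))
            (upTo (suc i)))
Eberlein -[1+ _ ] x N p = 0ℚ

Hahn : ℤ → ℤ → ℤ → ℤ → ℚ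
Hahn i x N p =
  ((binom N i - binom N (i ℤ.- + 1)) ÷ (binom p x * binom (N ℤ.- p) x)) * Eberlein x i N p

{-# OPTIONS --safe #-}
-- Write r = j + 1 and γ = N(N-1)⋯(N-j)/r!.  The leading coefficients C(N,r) - C(N,r-1),
-- N (C(N-1,r) - C(N-1,r-1)) and N (C(N-1,r-1) - C(N-1,r-2)) are γ (N-2r+1), γ (N-2r)(N-r+1)
-- and γ (N-2r+2) r, and p C(p-1,x) C(N-p,x) = (p-x) C(p,x) C(N-p,x).  After clearing these
-- factors the recurrence becomes the contiguity relation
--   (p-x)(N-2r+1) E_x(r,N,p) = (p-r)(N-r+1) E_x(r,N-1,p-1) + r(N-p-r+1) E_x(r-1,N-1,p-1).
-- It holds summand by summand up to the telescoping term
--   G(ℓ) = r (p-r) (-1)^ℓ C(r-1,ℓ-1) C(p-r-1,x-ℓ) C(N-p-r,x-ℓ),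
-- which is a polynomial identity once Pascal's rule and absorption j C(a,j) = (a-j+1) C(a,j-1)
-- tie together the binomials involved.  For r ≤ 0 there is nothing to do: H₀ = 1 and H_r = 0.
module Submission where

open import Defs
open import Data.Integer as ℤ using (ℤ; +_)
open import Data.Rational as ℚ using (ℚ; 0ℚ; _+_; _*_)
open import Relation.Binary.PropositionalEquality using (_≡_; _≢_)

open import Algebra.Bundles using (CommutativeMonoid)
open import Algebra.Bundles.Raw using (RawRing)
open import Data.Empty using (⊥-elim)
open import Data.Integer using (-[1+_])
import Data.Integer.Properties as ℤP
open import Data.Integer.Tactic.RingSolver using () renaming (solve-∀ to ℤ-solve-∀)
open import Data.List using (_∷_; map; applyUpTo)
open import Data.Nat as ℕ using (ℕ; zero; suc)
import Data.Nat.Properties as ℕP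
open import Data.Product using (_×_; _,_)
open import Data.Rational using (1ℚ; _-_; -_)
import Data.Rational.Properties as ℚP
open import Data.Rational.Solver using (module +-*-Solver)
import Data.Rational.Unnormalised as ℚᵘ
import Data.Rational.Unnormalised.Properties as ℚᵘP
open import Data.Sum as Sum using (_⊎_; inj₁; inj₂)
open import Function using (_∘_)
open import Level using (0ℓ)
open import Relation.Binary.PropositionalEquality
  using (refl; sym; trans; cong; cong₂; subst; module ≡-Reasoning)
open import Relation.Nullary using (yes; no)

open import Algebra.Properties.CommutativeSemigroup
  (CommutativeMonoid.commutativeSemigroup ℚP.*-1-commutativeMonoid)
  using (x∙yz≈yx∙z; xy∙z≈y∙xz; interchange)
open import Algebra.Properties.Group ℚP.+-0-group using (x∙y⁻¹≈ε⇒x≈y)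
open +-*-Solver using (solve; _:=_; _:+_; _:*_; _:-_; :-_; con; Polynomial)
open ≡-Reasoning

⟦⟧≃mkℚᵘ : ∀ z → ℚ.toℚᵘ ⟦ z ⟧ ℚᵘ.≃ ℚᵘ.mkℚᵘ z 0
⟦⟧≃mkℚᵘ z = ℚP.toℚᵘ-fromℚᵘ (ℚᵘ.mkℚᵘ z 0)

⟦⟧-homo-+ : ∀ a b → ⟦ a ℤ.+ b ⟧ ≡ ⟦ a ⟧ + ⟦ b ⟧
⟦⟧-homo-+ a b = ℚP.toℚᵘ-injective (ℚᵘP.≃-trans (⟦⟧≃mkℚᵘ (a ℤ.+ b)) (ℚᵘP.≃-sym (ℚᵘP.≃-trans
  (ℚP.toℚᵘ-homo-+ ⟦ a ⟧ ⟦ b ⟧)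
  (ℚᵘP.≃-trans (ℚᵘP.+-cong (⟦⟧≃mkℚᵘ a) (⟦⟧≃mkℚᵘ b)) (ℚᵘ.*≡* (cross-multiplied a b))))))
  where
  cross-multiplied : ∀ a b → (a ℤ.* + 1 ℤ.+ b ℤ.* + 1) ℤ.* + 1 ≡ (a ℤ.+ b) ℤ.* + 1
  cross-multiplied = ℤ-solve-∀

⟦⟧-homo-* : ∀ a b → ⟦ a ℤ.* b ⟧ ≡ ⟦ a ⟧ * ⟦ b ⟧
⟦⟧-homo-* a b = ℚP.toℚᵘ-injective (ℚᵘP.≃-trans (⟦⟧≃mkℚᵘ (a ℤ.* b)) (ℚᵘP.≃-sym (ℚᵘP.≃-trans
  (ℚP.toℚᵘ-homo-* ⟦ a ⟧ ⟦ b ⟧)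
  (ℚᵘP.≃-trans (ℚᵘP.*-cong (⟦⟧≃mkℚᵘ a) (⟦⟧≃mkℚᵘ b)) (ℚᵘ.*≡* refl)))))

⟦⟧-homo‿- : ∀ a → ⟦ ℤ.- a ⟧ ≡ - ⟦ a ⟧
⟦⟧-homo‿- a = ℚP.toℚᵘ-injective (ℚᵘP.≃-trans (⟦⟧≃mkℚᵘ (ℤ.- a))
  (ℚᵘP.≃-sym (ℚᵘP.≃-trans (ℚP.toℚᵘ-homo‿- ⟦ a ⟧) (ℚᵘP.-‿cong (⟦⟧≃mkℚᵘ a)))))

⟦⟧-homo-− : ∀ a b → ⟦ a ℤ.- b ⟧ ≡ ⟦ a ⟧ - ⟦ b ⟧
⟦⟧-homo-− a b = trans (⟦⟧-homo-+ a (ℤ.- b)) (cong (λ q → ⟦ a ⟧ + q) (⟦⟧-homo‿- b))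

⟦⟧-homo-−₂ : ∀ a b c → ⟦ a ℤ.- b ℤ.- c ⟧ ≡ ⟦ a ⟧ - ⟦ b ⟧ - ⟦ c ⟧
⟦⟧-homo-−₂ a b c = trans (⟦⟧-homo-− (a ℤ.- b) c) (cong (_- ⟦ c ⟧) (⟦⟧-homo-− a b))

⟦⟧-suc : ∀ k → ⟦ + suc k ⟧ ≡ ⟦ + k ⟧ + 1ℚ
⟦⟧-suc k = trans (cong (λ n → ⟦ + n ⟧) (ℕP.+-comm 1 k)) (⟦⟧-homo-+ (+ k) (+ 1))

⟦⟧≡0⇒≡0 : ∀ z → ⟦ z ⟧ ≡ 0ℚ → z ≡ + 0
⟦⟧≡0⇒≡0 z eq with ℚᵘP.≃-trans (ℚᵘP.≃-sym (⟦⟧≃mkℚᵘ z)) (ℚP.toℚᵘ-cong eq)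
... | ℚᵘ.*≡* z*1≡0 = trans (sym (ℤP.*-identityʳ z)) z*1≡0

⟦⟧≢0 : ∀ z → z ≢ + 0 → ⟦ z ⟧ ≢ 0ℚ
⟦⟧≢0 z z≢0 = z≢0 ∘ ⟦⟧≡0⇒≡0 z

inv-inverseʳ : ∀ {q} → q ≢ 0ℚ → q * inv q ≡ 1ℚ
inv-inverseʳ {q} q≢0 with q ℚP.≟ 0ℚ
... | yes q≡0 = ⊥-elim (q≢0 q≡0)
... | no q≢0′ = ℚP.*-inverseʳ q {{ℚ.≢-nonZero q≢0′}}

inv-unique : ∀ {z w} → z ≢ 0ℚ → z * w ≡ 1ℚ → inv z ≡ w
inv-unique {z} {w} z≢0 zw≡1 = begin
  inv z              ≡⟨ ℚP.*-identityʳ (inv z) ⟨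
  inv z * 1ℚ         ≡⟨ cong (inv z *_) zw≡1 ⟨
  inv z * (z * w)    ≡⟨ x∙yz≈yx∙z (inv z) z w ⟩
  z * inv z * w      ≡⟨ cong (_* w) (inv-inverseʳ z≢0) ⟩
  1ℚ * w             ≡⟨ ℚP.*-identityˡ w ⟩
  w                  ∎

x*y≡0⇒y≡0 : ∀ {x y} → x ≢ 0ℚ → x * y ≡ 0ℚ → y ≡ 0ℚ
x*y≡0⇒y≡0 {x} {y} x≢0 xy≡0 = begin
  y                  ≡⟨ ℚP.*-identityˡ y ⟨
  1ℚ * y             ≡⟨ cong (_* y) (inv-inverseʳ x≢0) ⟨
  x * inv x * y      ≡⟨ xy∙z≈y∙xz x (inv x) y ⟩
  inv x * (x * y)    ≡⟨ cong (inv x *_) xy≡0 ⟩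
  inv x * 0ℚ         ≡⟨ ℚP.*-zeroʳ (inv x) ⟩
  0ℚ                 ∎

inv-cross : ∀ {P B π A} → P ≢ 0ℚ → B ≢ 0ℚ → A ≢ 0ℚ → P * B ≡ π * A →
            inv A ≡ inv P * inv B * π
inv-cross {P} {B} {π} {A} P≢0 B≢0 A≢0 PB≡πA = inv-unique A≢0 (begin
  A * (inv P * inv B * π)    ≡⟨ swap A (inv P) (inv B) π ⟩
  π * A * (inv P * inv B)    ≡⟨ cong (_* (inv P * inv B)) PB≡πA ⟨
  P * B * (inv P * inv B)    ≡⟨ interchange P B (inv P) (inv B) ⟩
  P * inv P * (B * inv B)    ≡⟨ cong₂ _*_ (inv-inverseʳ P≢0) (inv-inverseʳ B≢0) ⟩
  1ℚ                         ∎)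
  where
  swap : ∀ a i j c → a * (i * j * c) ≡ c * a * (i * j)
  swap = solve 4 (λ a i j c → a :* (i :* j :* c) := c :* a :* (i :* j)) refl

-- Generalised binomial coefficients

invFact : ℕ → ℚ
invFact k = inv ⟦ + (k ℕ.!) ⟧

⟦⟧-fact≢0 : ∀ k → ⟦ + (k ℕ.!) ⟧ ≢ 0ℚ
⟦⟧-fact≢0 k = ⟦⟧≢0 _ (ℕ.≢-nonZero⁻¹ (k ℕ.!) {{k ℕP.!≢0}} ∘ ℤP.+-injective)

invFact-suc : ∀ k → invFact k ≡ ⟦ + suc k ⟧ * invFact (suc k)
invFact-suc k = inv-unique (⟦⟧-fact≢0 k) (begin
  ⟦ + (k ℕ.!) ⟧ * (⟦ + suc k ⟧ * invFact (suc k))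
    ≡⟨ x∙yz≈yx∙z ⟦ + (k ℕ.!) ⟧ ⟦ + suc k ⟧ (invFact (suc k)) ⟩
  ⟦ + suc k ⟧ * ⟦ + (k ℕ.!) ⟧ * invFact (suc k)
    ≡⟨ cong (_* invFact (suc k)) (⟦⟧-homo-* (+ suc k) (+ (k ℕ.!))) ⟨
  ⟦ + suc k ℤ.* + (k ℕ.!) ⟧ * invFact (suc k)
    ≡⟨ cong (λ z → ⟦ z ⟧ * invFact (suc k)) (ℤP.pos-* (suc k) (k ℕ.!)) ⟨
  ⟦ + (suc k ℕ.!) ⟧ * invFact (suc k)
    ≡⟨ inv-inverseʳ (⟦⟧-fact≢0 (suc k)) ⟩
  1ℚ ∎)

fall-pascal : ∀ a k → fall (a ℤ.+ + 1) (suc k) ≡ fall a (suc k) + ⟦ + suc k ⟧ * fall a k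
fall-pascal a zero = begin
  1ℚ * ⟦ a ℤ.+ + 1 ℤ.- + 0 ⟧        ≡⟨ cong (λ z → 1ℚ * ⟦ z ⟧) (shift a) ⟩
  1ℚ * ⟦ a ℤ.- + 0 ℤ.+ + 1 ⟧        ≡⟨ cong (1ℚ *_) (⟦⟧-homo-+ (a ℤ.- + 0) (+ 1)) ⟩
  1ℚ * (⟦ a ℤ.- + 0 ⟧ + 1ℚ)         ≡⟨ expand ⟦ a ℤ.- + 0 ⟧ ⟩
  1ℚ * ⟦ a ℤ.- + 0 ⟧ + 1ℚ * 1ℚ      ∎
  where
  shift : ∀ a → a ℤ.+ + 1 ℤ.- + 0 ≡ a ℤ.- + 0 ℤ.+ + 1
  shift = ℤ-solve-∀
  expand : ∀ x → 1ℚ * (x + 1ℚ) ≡ 1ℚ * x + 1ℚ * 1ℚ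
  expand = solve 1 (λ x → con 1ℚ :* (x :+ con 1ℚ) := con 1ℚ :* x :+ con 1ℚ :* con 1ℚ) refl
fall-pascal a (suc k) = begin
  fall (a ℤ.+ + 1) (suc k) * ⟦ a ℤ.+ + 1 ℤ.- + suc k ⟧
    ≡⟨ cong₂ _*_ (fall-pascal a k) (cong ⟦_⟧ (shift a (+ suc k))) ⟩
  (fall a k * X + S * fall a k) * X
    ≡⟨ expand (fall a k) X S ⟩
  fall a k * X * (X - 1ℚ) + (S + 1ℚ) * (fall a k * X)
    ≡⟨ cong₂ (λ x y → fall a k * X * x + y * (fall a k * X))
             (trans (cong ⟦_⟧ (shift′ a (+ suc k))) (⟦⟧-homo-− (a ℤ.- + k) (+ 1)))
             (⟦⟧-suc (suc k)) ⟨
  fall a (suc (suc k)) + ⟦ + suc (suc k) ⟧ * fall a (suc k) ∎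
  where
  X S : ℚ
  X = ⟦ a ℤ.- + k ⟧
  S = ⟦ + suc k ⟧
  -- Integer identities are stated for a variable t and used at t = + suc k,
  -- where t ℤ.- + 1 computes to + k.
  shift : ∀ a t → a ℤ.+ + 1 ℤ.- t ≡ a ℤ.- (t ℤ.- + 1)
  shift = ℤ-solve-∀
  shift′ : ∀ a t → a ℤ.- t ≡ a ℤ.- (t ℤ.- + 1) ℤ.- + 1
  shift′ = ℤ-solve-∀
  expand : ∀ f x s → (f * x + s * f) * x ≡ f * x * (x - 1ℚ) + (s + 1ℚ) * (f * x)
  expand = solve 3 (λ f x s →
    (f :* x :+ s :* f) :* x := f :* x :* (x :- con 1ℚ) :+ (s :+ con 1ℚ) :* (f :* x)) refl

binom-pascal : ∀ a j → binom (a ℤ.+ + 1) j ≡ binom a j + binom a (j ℤ.- + 1)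
binom-pascal a (+ zero)    = refl
binom-pascal a (+ suc k)   = begin
  fall (a ℤ.+ + 1) (suc k) * invFact (suc k)
    ≡⟨ cong (_* invFact (suc k)) (fall-pascal a k) ⟩
  (fall a (suc k) + ⟦ + suc k ⟧ * fall a k) * invFact (suc k)
    ≡⟨ distribute (fall a (suc k)) (fall a k) ⟦ + suc k ⟧ (invFact (suc k)) ⟩
  fall a (suc k) * invFact (suc k) + fall a k * (⟦ + suc k ⟧ * invFact (suc k))
    ≡⟨ cong (λ i → fall a (suc k) * invFact (suc k) + fall a k * i) (invFact-suc k) ⟨
  fall a (suc k) * invFact (suc k) + fall a k * invFact k ∎
  where
  distribute : ∀ f g s i → (f + s * g) * i ≡ f * i + g * (s * i)
  distribute = solve 4 (λ f g s i → (f :+ s :* g) :* i := f :* i :+ g :* (s :* i)) refl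
binom-pascal a -[1+ _ ]    = refl

binom-pascal′ : ∀ a j → binom a j ≡ binom (a ℤ.- + 1) j + binom (a ℤ.- + 1) (j ℤ.- + 1)
binom-pascal′ a j =
  subst (λ b → binom b j ≡ binom (a ℤ.- + 1) j + binom (a ℤ.- + 1) (j ℤ.- + 1))
        (cancel a) (binom-pascal (a ℤ.- + 1) j)
  where
  cancel : ∀ a → a ℤ.- + 1 ℤ.+ + 1 ≡ a
  cancel = ℤ-solve-∀

binom-absorb : ∀ a j → ⟦ j ⟧ * binom a j ≡ ⟦ a ℤ.- (j ℤ.- + 1) ⟧ * binom a (j ℤ.- + 1)
binom-absorb a (+ zero)  = sym (ℚP.*-zeroʳ ⟦ a ℤ.- -[1+ 0 ] ⟧)
binom-absorb a (+ suc k) = begin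
  ⟦ + suc k ⟧ * (fall a k * ⟦ a ℤ.- + k ⟧ * invFact (suc k))
    ≡⟨ swap ⟦ + suc k ⟧ (fall a k) ⟦ a ℤ.- + k ⟧ (invFact (suc k)) ⟩
  ⟦ a ℤ.- + k ⟧ * (fall a k * (⟦ + suc k ⟧ * invFact (suc k)))
    ≡⟨ cong (λ i → ⟦ a ℤ.- + k ⟧ * (fall a k * i)) (invFact-suc k) ⟨
  ⟦ a ℤ.- + k ⟧ * (fall a k * invFact k) ∎
  where
  swap : ∀ s f x i → s * (f * x * i) ≡ x * (f * (s * i))
  swap = solve 4 (λ s f x i → s :* (f :* x :* i) := x :* (f :* (s :* i))) refl
binom-absorb a j@(-[1+ _ ]) = trans (ℚP.*-zeroʳ ⟦ j ⟧) (sym (ℚP.*-zeroʳ ⟦ a ℤ.- (j ℤ.- + 1) ⟧))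

binom-pred-upper : ∀ p j → ⟦ p ⟧ * binom (p ℤ.- + 1) j ≡ ⟦ p ℤ.- j ⟧ * binom p j
binom-pred-upper p j = begin
  ⟦ p ⟧ * C₁                             ≡⟨ split ⟦ p ⟧ ⟦ j ⟧ C₁ ⟩
  (⟦ p ⟧ - ⟦ j ⟧) * C₁ + ⟦ j ⟧ * C₁      ≡⟨ cong₂ (λ x y → x * C₁ + y) (sym (⟦⟧-homo-− p j)) absorbed ⟩
  ⟦ p ℤ.- j ⟧ * C₁ + ⟦ p ℤ.- j ⟧ * C₀    ≡⟨ ℚP.*-distribˡ-+ ⟦ p ℤ.- j ⟧ C₁ C₀ ⟨
  ⟦ p ℤ.- j ⟧ * (C₁ + C₀)               ≡⟨ cong (⟦ p ℤ.- j ⟧ *_) (binom-pascal′ p j) ⟨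
  ⟦ p ℤ.- j ⟧ * binom p j               ∎
  where
  C₀ C₁ : ℚ
  C₀ = binom (p ℤ.- + 1) (j ℤ.- + 1)
  C₁ = binom (p ℤ.- + 1) j
  split : ∀ x y c → x * c ≡ (x - y) * c + y * c
  split = solve 3 (λ x y c → x :* c := (x :- y) :* c :+ y :* c) refl
  shift : ∀ p j → p ℤ.- + 1 ℤ.- (j ℤ.- + 1) ≡ p ℤ.- j
  shift = ℤ-solve-∀
  absorbed : ⟦ j ⟧ * C₁ ≡ ⟦ p ℤ.- j ⟧ * C₀
  absorbed = trans (binom-absorb (p ℤ.- + 1) j) (cong (λ z → ⟦ z ⟧ * C₀) (shift p j))

fall-pred-upper : ∀ N k → ⟦ N ⟧ * fall (N ℤ.- + 1) k ≡ fall N (suc k)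
fall-pred-upper N zero = trans (ℚP.*-comm ⟦ N ⟧ 1ℚ) (cong (λ z → 1ℚ * ⟦ z ⟧) (sym (ℤP.+-identityʳ N)))
fall-pred-upper N (suc k) = begin
  ⟦ N ⟧ * (fall (N ℤ.- + 1) k * ⟦ N ℤ.- + 1 ℤ.- + k ⟧)
    ≡⟨ ℚP.*-assoc ⟦ N ⟧ _ _ ⟨
  ⟦ N ⟧ * fall (N ℤ.- + 1) k * ⟦ N ℤ.- + 1 ℤ.- + k ⟧
    ≡⟨ cong₂ _*_ (fall-pred-upper N k) (cong ⟦_⟧ (shift N (+ suc k))) ⟩
  fall N (suc k) * ⟦ N ℤ.- + suc k ⟧ ∎
  where
  shift : ∀ N t → N ℤ.- + 1 ℤ.- (t ℤ.- + 1) ≡ N ℤ.- t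
  shift = ℤ-solve-∀

binom-zero-upper : ∀ k → binom (+ 0) (+ suc k) ≡ 0ℚ
binom-zero-upper k = trans (cong (_* invFact (suc k)) (fall-zero k)) (ℚP.*-zeroˡ (invFact (suc k)))
  where
  fall-zero : ∀ k → fall (+ 0) (suc k) ≡ 0ℚ
  fall-zero zero    = refl
  fall-zero (suc k) =
    trans (cong (_* ⟦ + 0 ℤ.- + suc k ⟧) (fall-zero k)) (ℚP.*-zeroˡ ⟦ + 0 ℤ.- + suc k ⟧)

≢0⊎binom-pred≡0 : ∀ j → ⟦ j ⟧ ≢ 0ℚ ⊎ (⟦ j ⟧ ≡ 0ℚ × (∀ a → binom a (j ℤ.- + 1) ≡ 0ℚ))
≢0⊎binom-pred≡0 (+ zero)  = inj₂ (refl , λ _ → refl)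
≢0⊎binom-pred≡0 (+ suc k) = inj₁ (⟦⟧≢0 (+ suc k) λ ())
≢0⊎binom-pred≡0 -[1+ k ]  = inj₁ (⟦⟧≢0 -[1+ k ] λ ())

-- Finite sums and the Eberlein polynomial

sumUpTo : (ℕ → ℚ) → ℕ → ℚ
sumUpTo f n = sumℚ (applyUpTo f n)

map-applyUpTo : ∀ {A B : Set} (f : A → B) (g : ℕ → A) n → map f (applyUpTo g n) ≡ applyUpTo (f ∘ g) n
map-applyUpTo f g zero    = refl
map-applyUpTo f g (suc n) = cong (f (g 0) ∷_) (map-applyUpTo f (g ∘ suc) n)

sumUpTo-zero : ∀ f n → (∀ ℓ → f ℓ ≡ 0ℚ) → sumUpTo f n ≡ 0ℚ
sumUpTo-zero f zero    f≡0 = refl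
sumUpTo-zero f (suc n) f≡0 =
  trans (cong₂ _+_ (f≡0 0) (sumUpTo-zero (f ∘ suc) n (f≡0 ∘ suc))) (ℚP.+-identityˡ 0ℚ)

sumUpTo-telescoping : ∀ (c a b : ℚ) (f g h G : ℕ → ℚ) →
  (∀ ℓ → c * f ℓ ≡ a * g ℓ + b * h ℓ + (G (suc ℓ) - G ℓ)) →
  ∀ n → c * sumUpTo f n ≡ a * sumUpTo g n + b * sumUpTo h n + (G n - G 0)
sumUpTo-telescoping c a b f g h G step zero = empty c a b (G 0)
  where
  empty : ∀ c a b x → c * 0ℚ ≡ a * 0ℚ + b * 0ℚ + (x - x)
  empty = solve 4 (λ c a b x → c :* con 0ℚ := a :* con 0ℚ :+ b :* con 0ℚ :+ (x :- x)) refl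
sumUpTo-telescoping c a b f g h G step (suc n) = begin
  c * (f 0 + sumUpTo (f ∘ suc) n)
    ≡⟨ ℚP.*-distribˡ-+ c (f 0) _ ⟩
  c * f 0 + c * sumUpTo (f ∘ suc) n
    ≡⟨ cong₂ _+_ (step 0)
         (sumUpTo-telescoping c a b (f ∘ suc) (g ∘ suc) (h ∘ suc) (G ∘ suc) (step ∘ suc) n) ⟩
  a * g 0 + b * h 0 + (G 1 - G 0) + (a * Σg + b * Σh + (G (suc n) - G 1))
    ≡⟨ regroup a b (g 0) (h 0) Σg Σh (G 0) (G 1) (G (suc n)) ⟩
  a * (g 0 + Σg) + b * (h 0 + Σh) + (G (suc n) - G 0) ∎
  where
  Σg Σh : ℚ
  Σg = sumUpTo (g ∘ suc) n
  Σh = sumUpTo (h ∘ suc) n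
  regroup : ∀ a b g₀ h₀ σg σh G₀ G₁ Gₙ →
    a * g₀ + b * h₀ + (G₁ - G₀) + (a * σg + b * σh + (Gₙ - G₁))
      ≡ a * (g₀ + σg) + b * (h₀ + σh) + (Gₙ - G₀)
  regroup = solve 9 (λ a b g₀ h₀ σg σh G₀ G₁ Gₙ →
    a :* g₀ :+ b :* h₀ :+ (G₁ :- G₀) :+ (a :* σg :+ b :* σh :+ (Gₙ :- G₁))
      := a :* (g₀ :+ σg) :+ b :* (h₀ :+ σh) :+ (Gₙ :- G₀)) refl

eberleinTerm : ℤ → ℤ → ℤ → ℤ → ℕ → ℚ
eberleinTerm x N p i ℓ =
  sgn ℓ * binom x (+ ℓ) * binom (p ℤ.- x) (i ℤ.- + ℓ) * binom (N ℤ.- p ℤ.- x) (i ℤ.- + ℓ)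

Eberlein≡sumUpTo : ∀ n x N p → Eberlein (+ n) x N p ≡ sumUpTo (eberleinTerm x N p (+ n)) (suc n)
Eberlein≡sumUpTo n x N p = cong sumℚ (map-applyUpTo (eberleinTerm x N p (+ n)) (λ ℓ → ℓ) (suc n))

Eberlein-at-zero : ∀ n N p → Eberlein (+ n) (+ 0) N p ≡ binom p (+ n) * binom (N ℤ.- p) (+ n)
Eberlein-at-zero n N p = begin
  Eberlein (+ n) (+ 0) N p
    ≡⟨ Eberlein≡sumUpTo n (+ 0) N p ⟩
  T 0 + sumUpTo (T ∘ suc) n
    ≡⟨ cong (λ σ → T 0 + σ) (sumUpTo-zero (T ∘ suc) n higher-terms) ⟩
  T 0 + 0ℚ
    ≡⟨ ℚP.+-identityʳ (T 0) ⟩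
  1ℚ * 1ℚ * binom (p ℤ.- + 0) (+ n ℤ.- + 0) * binom (N ℤ.- p ℤ.- + 0) (+ n ℤ.- + 0)
    ≡⟨ cong₂ (λ a b → 1ℚ * 1ℚ * a * b)
         (cong₂ binom (ℤP.+-identityʳ p) (ℤP.+-identityʳ (+ n)))
         (cong₂ binom (ℤP.+-identityʳ (N ℤ.- p)) (ℤP.+-identityʳ (+ n))) ⟩
  1ℚ * 1ℚ * binom p (+ n) * binom (N ℤ.- p) (+ n)
    ≡⟨ unit (binom p (+ n)) (binom (N ℤ.- p) (+ n)) ⟩
  binom p (+ n) * binom (N ℤ.- p) (+ n) ∎
  where
  T : ℕ → ℚ
  T = eberleinTerm (+ 0) N p (+ n)
  unit : ∀ a b → 1ℚ * 1ℚ * a * b ≡ a * b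
  unit = solve 2 (λ a b → con 1ℚ :* con 1ℚ :* a :* b := a :* b) refl
  vanish : ∀ s a b → s * 0ℚ * a * b ≡ 0ℚ
  vanish = solve 3 (λ s a b → s :* con 0ℚ :* a :* b := con 0ℚ) refl
  higher-terms : ∀ ℓ → T (suc ℓ) ≡ 0ℚ
  higher-terms ℓ =
    trans (cong (λ z → sgn (suc ℓ) * z * B₁ * B₂) (binom-zero-upper ℓ)) (vanish (sgn (suc ℓ)) B₁ B₂)
    where
    B₁ B₂ : ℚ
    B₁ = binom (p ℤ.- + 0) (+ n ℤ.- + suc ℓ)
    B₂ = binom (N ℤ.- p ℤ.- + 0) (+ n ℤ.- + suc ℓ)

-- The term-wise contiguity relation

-- After Pascal's rule, the ℓ-th summands of the three Eberlein polynomials and the telescoping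
-- term are trilinear in u = (C(r-1,ℓ-1), C(r-1,ℓ)), v = (C(p-r-1,m-1), C(p-r-1,m)) and
-- w = (C(N-p-r,m-1), C(N-p-r,m)), where m = x - ℓ, s = (-1)^ℓ, and L M R N P stand for ℓ m r N p.
-- The relation is stated over any raw ring so that the same expression also serves as solver syntax.
module Contiguity (ℛ : RawRing 0ℓ 0ℓ) where
  open RawRing ℛ using (Carrier) renaming (_+_ to _⊕_; _*_ to _⊗_; -_ to ⊖_; 1# to 𝟙)

  lhs rhs defect : (L M R N P s u₀ u₁ v₀ v₁ w₀ w₁ : Carrier) → Carrier
  lhs L M R N P s u₀ u₁ v₀ v₁ w₀ w₁ =
    (P ⊕ ⊖ (L ⊕ M)) ⊗ (N ⊕ ⊖ (R ⊕ R) ⊕ 𝟙) ⊗ (s ⊗ (u₁ ⊕ u₀) ⊗ (v₁ ⊕ v₀) ⊗ w₁)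
  rhs L M R N P s u₀ u₁ v₀ v₁ w₀ w₁ =
    (P ⊕ ⊖ R) ⊗ (N ⊕ ⊖ R ⊕ 𝟙) ⊗ (s ⊗ (u₁ ⊕ u₀) ⊗ v₁ ⊗ w₁)
    ⊕ R ⊗ (N ⊕ ⊖ P ⊕ ⊖ R ⊕ 𝟙) ⊗ (s ⊗ u₁ ⊗ (v₁ ⊕ v₀) ⊗ (w₁ ⊕ w₀))
    ⊕ (R ⊗ (P ⊕ ⊖ R) ⊗ (⊖ s ⊗ u₁ ⊗ v₀ ⊗ w₀) ⊕ ⊖ (R ⊗ (P ⊕ ⊖ R) ⊗ (s ⊗ u₀ ⊗ v₁ ⊗ w₁)))
  defect L M R N P s u₀ u₁ v₀ v₁ w₀ w₁ =
    lhs L M R N P s u₀ u₁ v₀ v₁ w₀ w₁ ⊕ ⊖ rhs L M R N P s u₀ u₁ v₀ v₁ w₀ w₁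

module ℚContiguity = Contiguity ℚ.+-*-rawRing
open ℚContiguity using (defect)

private
  polynomials : ℕ → RawRing 0ℓ 0ℓ
  polynomials n = record
    { Carrier = Polynomial n ; _≈_ = _≡_ ; _+_ = _:+_ ; _*_ = _:*_ ; -_ = :-_
    ; 0# = con 0ℚ ; 1# = con 1ℚ }

  ⌜defect⌝ : ∀ {n} (L M R N P s u₀ u₁ v₀ v₁ w₀ w₁ : Polynomial n) → Polynomial n
  ⌜defect⌝ {n} = Contiguity.defect (polynomials n)

defect-scaleᵘ : ∀ a L M R N P s u₀ u₁ v₀ v₁ w₀ w₁ →
  a * defect L M R N P s u₀ u₁ v₀ v₁ w₀ w₁ ≡ defect L M R N P s (a * u₀) (a * u₁) v₀ v₁ w₀ w₁
defect-scaleᵘ = solve 13 (λ a L M R N P s u₀ u₁ v₀ v₁ w₀ w₁ →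
  a :* ⌜defect⌝ L M R N P s u₀ u₁ v₀ v₁ w₀ w₁
    := ⌜defect⌝ L M R N P s (a :* u₀) (a :* u₁) v₀ v₁ w₀ w₁) refl

defect-scaleᵛʷ : ∀ b L M R N P s u₀ u₁ v₀ v₁ w₀ w₁ →
  b * (b * defect L M R N P s u₀ u₁ v₀ v₁ w₀ w₁)
    ≡ defect L M R N P s u₀ u₁ (b * v₀) (b * v₁) (b * w₀) (b * w₁)
defect-scaleᵛʷ = solve 13 (λ b L M R N P s u₀ u₁ v₀ v₁ w₀ w₁ →
  b :* (b :* ⌜defect⌝ L M R N P s u₀ u₁ v₀ v₁ w₀ w₁)
    := ⌜defect⌝ L M R N P s u₀ u₁ (b :* v₀) (b :* v₁) (b :* w₀) (b :* w₁)) refl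

defect-vanishes-generically : ∀ L M R N P s u v w →
  defect L M R N P s (L * u) ((R - L) * u) (M * v) ((P - R - M) * v)
                     (M * w) ((N - P - R - M + 1ℚ) * w) ≡ 0ℚ
defect-vanishes-generically = solve 9 (λ L M R N P s u v w →
  ⌜defect⌝ L M R N P s (L :* u) ((R :- L) :* u) (M :* v) ((P :- R :- M) :* v)
                (M :* w) ((N :- P :- R :- M :+ con 1ℚ) :* w) := con 0ℚ) refl

defect-at-ℓ≡0 : ∀ M R N P s u₁ v w →
  defect 0ℚ M R N P s 0ℚ u₁ (M * v) ((P - R - M) * v) (M * w) ((N - P - R - M + 1ℚ) * w) ≡ 0ℚ
defect-at-ℓ≡0 = solve 8 (λ M R N P s u₁ v w →
  ⌜defect⌝ (con 0ℚ) M R N P s (con 0ℚ) u₁ (M :* v) ((P :- R :- M) :* v)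
    (M :* w) ((N :- P :- R :- M :+ con 1ℚ) :* w) := con 0ℚ) refl

defect-at-m≡0 : ∀ L R N P s u v₁ w₁ →
  defect L 0ℚ R N P s (L * u) ((R - L) * u) 0ℚ v₁ 0ℚ w₁ ≡ 0ℚ
defect-at-m≡0 = solve 8 (λ L R N P s u v₁ w₁ →
  ⌜defect⌝ L (con 0ℚ) R N P s (L :* u) ((R :- L) :* u) (con 0ℚ) v₁ (con 0ℚ) w₁ := con 0ℚ) refl

defect-at-ℓ≡m≡0 : ∀ R N P s u₁ v₁ w₁ → defect 0ℚ 0ℚ R N P s 0ℚ u₁ 0ℚ v₁ 0ℚ w₁ ≡ 0ℚ
defect-at-ℓ≡m≡0 = solve 7 (λ R N P s u₁ v₁ w₁ →
  ⌜defect⌝ (con 0ℚ) (con 0ℚ) R N P s (con 0ℚ) u₁ (con 0ℚ) v₁ (con 0ℚ) w₁ := con 0ℚ) refl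

-- The absorption relations determine u up to scaling only when L ≠ 0, and otherwise u₀ = 0
-- (likewise for v, w and M); multiplying by L and M² turns every case into a polynomial identity.
defect-vanishes : ∀ {L M R N P u₀ u₁ v₀ v₁ w₀ w₁} s →
  L * u₁ ≡ (R - L) * u₀ → M * v₁ ≡ (P - R - M) * v₀ → M * w₁ ≡ (N - P - R - M + 1ℚ) * w₀ →
  L ≢ 0ℚ ⊎ (L ≡ 0ℚ × u₀ ≡ 0ℚ) → M ≢ 0ℚ ⊎ (M ≡ 0ℚ × v₀ ≡ 0ℚ × w₀ ≡ 0ℚ) →
  defect L M R N P s u₀ u₁ v₀ v₁ w₀ w₁ ≡ 0ℚ
defect-vanishes {L} {M} {R} {N} {P} {u₀} {u₁} {v₀} {v₁} {w₀} {w₁} s u-rel v-rel w-rel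
  (inj₁ L≢0) (inj₁ M≢0) =
  x*y≡0⇒y≡0 M≢0 (x*y≡0⇒y≡0 M≢0 (x*y≡0⇒y≡0 L≢0 (begin
    L * (M * (M * defect L M R N P s u₀ u₁ v₀ v₁ w₀ w₁))
      ≡⟨ cong (L *_) (defect-scaleᵛʷ M L M R N P s u₀ u₁ v₀ v₁ w₀ w₁) ⟩
    L * defect L M R N P s u₀ u₁ (M * v₀) (M * v₁) (M * w₀) (M * w₁)
      ≡⟨ defect-scaleᵘ L L M R N P s u₀ u₁ (M * v₀) (M * v₁) (M * w₀) (M * w₁) ⟩
    defect L M R N P s (L * u₀) (L * u₁) (M * v₀) (M * v₁) (M * w₀) (M * w₁)
      ≡⟨ substituted ⟩
    0ℚ ∎)))
  where
  substituted : defect L M R N P s (L * u₀) (L * u₁) (M * v₀) (M * v₁) (M * w₀) (M * w₁) ≡ 0ℚ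
  substituted rewrite u-rel | v-rel | w-rel = defect-vanishes-generically L M R N P s u₀ v₀ w₀
defect-vanishes {L} {_} {R} {N} {P} {u₀} {u₁} {_} {v₁} {_} {w₁} s u-rel v-rel w-rel
  (inj₁ L≢0) (inj₂ (refl , refl , refl)) =
  x*y≡0⇒y≡0 L≢0 (trans (defect-scaleᵘ L L 0ℚ R N P s u₀ u₁ 0ℚ v₁ 0ℚ w₁) substituted)
  where
  substituted : defect L 0ℚ R N P s (L * u₀) (L * u₁) 0ℚ v₁ 0ℚ w₁ ≡ 0ℚ
  substituted rewrite u-rel = defect-at-m≡0 L R N P s u₀ v₁ w₁
defect-vanishes {_} {M} {R} {N} {P} {_} {u₁} {v₀} {v₁} {w₀} {w₁} s u-rel v-rel w-rel
  (inj₂ (refl , refl)) (inj₁ M≢0) =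
  x*y≡0⇒y≡0 M≢0 (x*y≡0⇒y≡0 M≢0
    (trans (defect-scaleᵛʷ M 0ℚ M R N P s 0ℚ u₁ v₀ v₁ w₀ w₁) substituted))
  where
  substituted : defect 0ℚ M R N P s 0ℚ u₁ (M * v₀) (M * v₁) (M * w₀) (M * w₁) ≡ 0ℚ
  substituted rewrite v-rel | w-rel = defect-at-ℓ≡0 M R N P s u₁ v₀ w₀
defect-vanishes {_} {_} {R} {N} {P} {_} {u₁} {_} {v₁} {_} {w₁} s u-rel v-rel w-rel
  (inj₂ (refl , refl)) (inj₂ (refl , refl , refl)) = defect-at-ℓ≡m≡0 R N P s u₁ v₁ w₁

-- Vanishes at ℓ = 0 and at ℓ = i + 1, so it cancels from the sum over ℓ ≤ i.
contiguityCertificate : ℤ → ℤ → ℤ → ℤ → ℕ → ℚ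
contiguityCertificate r N p i ℓ =
  ⟦ r ⟧ * ⟦ p ℤ.- r ⟧
    * (sgn ℓ * binom (r ℤ.- + 1) (+ ℓ ℤ.- + 1) * binom (p ℤ.- r ℤ.- + 1) (i ℤ.- + ℓ)
             * binom (N ℤ.- p ℤ.- r) (i ℤ.- + ℓ))

eberleinTerm-contiguity : ∀ r N p i ℓ →
  ⟦ p ℤ.- i ⟧ * ⟦ N ℤ.- + 2 ℤ.* r ℤ.+ + 1 ⟧ * eberleinTerm r N p i ℓ ≡
    ⟦ p ℤ.- r ⟧ * ⟦ N ℤ.- r ℤ.+ + 1 ⟧ * eberleinTerm r (N ℤ.- + 1) (p ℤ.- + 1) i ℓ
  + ⟦ r ⟧ * ⟦ N ℤ.- p ℤ.- r ℤ.+ + 1 ⟧ * eberleinTerm (r ℤ.- + 1) (N ℤ.- + 1) (p ℤ.- + 1) i ℓ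
  + (contiguityCertificate r N p i (suc ℓ) - contiguityCertificate r N p i ℓ)
eberleinTerm-contiguity r N p i ℓ = begin
  ⟦ p ℤ.- i ⟧ * ⟦ N ℤ.- + 2 ℤ.* r ℤ.+ + 1 ⟧ * eberleinTerm r N p i ℓ
    ≡⟨ cong₂ _*_ (cong₂ _*_ ⟦p-i⟧ ⟦N-2r+1⟧) T₁-split ⟩
  ℚContiguity.lhs L M R N̂ P̂ s u₀ u₁ v₀ v₁ w₀ w₁
    ≡⟨ x∙y⁻¹≈ε⇒x≈y _ _ (defect-vanishes {R = R} {N = N̂} {P = P̂} s u-rel v-rel w-rel ℓ-cases m-cases) ⟩
  ℚContiguity.rhs L M R N̂ P̂ s u₀ u₁ v₀ v₁ w₀ w₁
    ≡⟨ cong₂ _+_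
         (cong₂ _+_ (cong₂ _*_ (cong₂ _*_ (⟦⟧-homo-− p r) ⟦N-r+1⟧) T₂-split)
                    (cong₂ _*_ (cong (R *_) ⟦N-p-r+1⟧) T₃-split))
         (cong₂ _-_ G-suc G-ℓ) ⟨
  ⟦ p ℤ.- r ⟧ * ⟦ N ℤ.- r ℤ.+ + 1 ⟧ * eberleinTerm r (N ℤ.- + 1) (p ℤ.- + 1) i ℓ
  + ⟦ r ⟧ * ⟦ N ℤ.- p ℤ.- r ℤ.+ + 1 ⟧ * eberleinTerm (r ℤ.- + 1) (N ℤ.- + 1) (p ℤ.- + 1) i ℓ
  + (contiguityCertificate r N p i (suc ℓ) - contiguityCertificate r N p i ℓ) ∎
  where
  m : ℤ
  m = i ℤ.- + ℓ
  s L M R N̂ P̂ u₀ u₁ v₀ v₁ w₀ w₁ : ℚ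
  s = sgn ℓ
  L = ⟦ + ℓ ⟧
  M = ⟦ m ⟧
  R = ⟦ r ⟧
  N̂ = ⟦ N ⟧
  P̂ = ⟦ p ⟧
  u₀ = binom (r ℤ.- + 1) (+ ℓ ℤ.- + 1)
  u₁ = binom (r ℤ.- + 1) (+ ℓ)
  v₀ = binom (p ℤ.- r ℤ.- + 1) (m ℤ.- + 1)
  v₁ = binom (p ℤ.- r ℤ.- + 1) m
  w₀ = binom (N ℤ.- p ℤ.- r) (m ℤ.- + 1)
  w₁ = binom (N ℤ.- p ℤ.- r) m

  ⟦p-i⟧ : ⟦ p ℤ.- i ⟧ ≡ P̂ - (L + M)
  ⟦p-i⟧ = trans (cong ⟦_⟧ (split p i (+ ℓ)))
                (trans (⟦⟧-homo-− p (+ ℓ ℤ.+ m)) (cong (λ q → P̂ - q) (⟦⟧-homo-+ (+ ℓ) m)))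
    where
    split : ∀ p i l → p ℤ.- i ≡ p ℤ.- (l ℤ.+ (i ℤ.- l))
    split = ℤ-solve-∀
  ⟦N-2r+1⟧ : ⟦ N ℤ.- + 2 ℤ.* r ℤ.+ + 1 ⟧ ≡ N̂ - (R + R) + 1ℚ
  ⟦N-2r+1⟧ = trans (cong ⟦_⟧ (double N r)) (trans (⟦⟧-homo-+ (N ℤ.- (r ℤ.+ r)) (+ 1))
               (cong (_+ 1ℚ) (trans (⟦⟧-homo-− N (r ℤ.+ r)) (cong (λ q → N̂ - q) (⟦⟧-homo-+ r r)))))
    where
    double : ∀ N r → N ℤ.- + 2 ℤ.* r ℤ.+ + 1 ≡ N ℤ.- (r ℤ.+ r) ℤ.+ + 1
    double = ℤ-solve-∀
  ⟦N-r+1⟧ : ⟦ N ℤ.- r ℤ.+ + 1 ⟧ ≡ N̂ - R + 1ℚ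
  ⟦N-r+1⟧ = trans (⟦⟧-homo-+ (N ℤ.- r) (+ 1)) (cong (_+ 1ℚ) (⟦⟧-homo-− N r))
  ⟦N-p-r+1⟧ : ⟦ N ℤ.- p ℤ.- r ℤ.+ + 1 ⟧ ≡ N̂ - P̂ - R + 1ℚ
  ⟦N-p-r+1⟧ = trans (⟦⟧-homo-+ (N ℤ.- p ℤ.- r) (+ 1)) (cong (_+ 1ℚ) (⟦⟧-homo-−₂ N p r))

  term-cong : ∀ {a b c a′ b′ c′} → a ≡ a′ → b ≡ b′ → c ≡ c′ → s * a * b * c ≡ s * a′ * b′ * c′
  term-cong refl refl refl = refl
  T₁-split : eberleinTerm r N p i ℓ ≡ s * (u₁ + u₀) * (v₁ + v₀) * w₁
  T₁-split = term-cong (binom-pascal′ r (+ ℓ)) (binom-pascal′ (p ℤ.- r) m) refl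
  T₂-split : eberleinTerm r (N ℤ.- + 1) (p ℤ.- + 1) i ℓ ≡ s * (u₁ + u₀) * v₁ * w₁
  T₂-split = term-cong (binom-pascal′ r (+ ℓ))
    (cong (λ a → binom a m) (shift p r)) (cong (λ a → binom a m) (shift′ N p r))
    where
    shift : ∀ p r → p ℤ.- + 1 ℤ.- r ≡ p ℤ.- r ℤ.- + 1
    shift = ℤ-solve-∀
    shift′ : ∀ N p r → N ℤ.- + 1 ℤ.- (p ℤ.- + 1) ℤ.- r ≡ N ℤ.- p ℤ.- r
    shift′ = ℤ-solve-∀
  T₃-split : eberleinTerm (r ℤ.- + 1) (N ℤ.- + 1) (p ℤ.- + 1) i ℓ ≡ s * u₁ * (v₁ + v₀) * (w₁ + w₀)
  T₃-split = term-cong refl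
    (trans (cong (λ a → binom a m) (shift p r)) (binom-pascal′ (p ℤ.- r) m))
    (trans (cong (λ a → binom a m) (shift′ N p r)) (binom-pascal (N ℤ.- p ℤ.- r) m))
    where
    shift : ∀ p r → p ℤ.- + 1 ℤ.- (r ℤ.- + 1) ≡ p ℤ.- r
    shift = ℤ-solve-∀
    shift′ : ∀ N p r → N ℤ.- + 1 ℤ.- (p ℤ.- + 1) ℤ.- (r ℤ.- + 1) ≡ N ℤ.- p ℤ.- r ℤ.+ + 1
    shift′ = ℤ-solve-∀

  G-suc : contiguityCertificate r N p i (suc ℓ) ≡ R * (P̂ - R) * (- s * u₁ * v₀ * w₀)
  G-suc = cong₂ _*_ (cong (R *_) (⟦⟧-homo-− p r))
    (cong₂ (λ a b → - s * u₁ * a * b)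
      (cong (binom (p ℤ.- r ℤ.- + 1)) (shift i (+ suc ℓ)))
      (cong (binom (N ℤ.- p ℤ.- r)) (shift i (+ suc ℓ))))
    where
    shift : ∀ i t → i ℤ.- t ≡ i ℤ.- (t ℤ.- + 1) ℤ.- + 1
    shift = ℤ-solve-∀
  G-ℓ : contiguityCertificate r N p i ℓ ≡ R * (P̂ - R) * (s * u₀ * v₁ * w₁)
  G-ℓ = cong (λ k → R * k * (s * u₀ * v₁ * w₁)) (⟦⟧-homo-− p r)

  u-rel : L * u₁ ≡ (R - L) * u₀
  u-rel = trans (binom-absorb (r ℤ.- + 1) (+ ℓ))
    (cong (_* u₀) (trans (cong ⟦_⟧ (shift r (+ ℓ))) (⟦⟧-homo-− r (+ ℓ))))
    where
    shift : ∀ r l → r ℤ.- + 1 ℤ.- (l ℤ.- + 1) ≡ r ℤ.- l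
    shift = ℤ-solve-∀
  v-rel : M * v₁ ≡ (P̂ - R - M) * v₀
  v-rel = trans (binom-absorb (p ℤ.- r ℤ.- + 1) m)
    (cong (_* v₀) (trans (cong ⟦_⟧ (shift p r m)) (⟦⟧-homo-−₂ p r m)))
    where
    shift : ∀ p r m → p ℤ.- r ℤ.- + 1 ℤ.- (m ℤ.- + 1) ≡ p ℤ.- r ℤ.- m
    shift = ℤ-solve-∀
  w-rel : M * w₁ ≡ (N̂ - P̂ - R - M + 1ℚ) * w₀
  w-rel = trans (binom-absorb (N ℤ.- p ℤ.- r) m)
    (cong (_* w₀) (trans (cong ⟦_⟧ (shift N p r m))
      (trans (⟦⟧-homo-+ (N ℤ.- p ℤ.- r ℤ.- m) (+ 1))
        (cong (_+ 1ℚ) (trans (⟦⟧-homo-− (N ℤ.- p ℤ.- r) m) (cong (_- M) (⟦⟧-homo-−₂ N p r)))))))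
    where
    shift : ∀ N p r m → N ℤ.- p ℤ.- r ℤ.- (m ℤ.- + 1) ≡ N ℤ.- p ℤ.- r ℤ.- m ℤ.+ + 1
    shift = ℤ-solve-∀

  ℓ-cases : L ≢ 0ℚ ⊎ (L ≡ 0ℚ × u₀ ≡ 0ℚ)
  ℓ-cases = Sum.map₂ (λ { (L≡0 , below) → L≡0 , below (r ℤ.- + 1) }) (≢0⊎binom-pred≡0 (+ ℓ))
  m-cases : M ≢ 0ℚ ⊎ (M ≡ 0ℚ × v₀ ≡ 0ℚ × w₀ ≡ 0ℚ)
  m-cases = Sum.map₂ (λ { (M≡0 , below) → M≡0 , below (p ℤ.- r ℤ.- + 1) , below (N ℤ.- p ℤ.- r) })
                     (≢0⊎binom-pred≡0 m)

Eberlein-contiguity : ∀ n r N p →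
  ⟦ p ℤ.- + n ⟧ * ⟦ N ℤ.- + 2 ℤ.* r ℤ.+ + 1 ⟧ * Eberlein (+ n) r N p ≡
    ⟦ p ℤ.- r ⟧ * ⟦ N ℤ.- r ℤ.+ + 1 ⟧ * Eberlein (+ n) r (N ℤ.- + 1) (p ℤ.- + 1)
  + ⟦ r ⟧ * ⟦ N ℤ.- p ℤ.- r ℤ.+ + 1 ⟧ * Eberlein (+ n) (r ℤ.- + 1) (N ℤ.- + 1) (p ℤ.- + 1)
Eberlein-contiguity n r N p = begin
  c₁ * Eberlein (+ n) r N p
    ≡⟨ cong (c₁ *_) (Eberlein≡sumUpTo n r N p) ⟩
  c₁ * sumUpTo (eberleinTerm r N p (+ n)) (suc n)
    ≡⟨ sumUpTo-telescoping c₁ c₂ c₃ _ _ _ G (eberleinTerm-contiguity r N p (+ n)) (suc n) ⟩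
  c₂ * Σ₂ + c₃ * Σ₃ + (G (suc n) - G 0)
    ≡⟨ cong (λ g → c₂ * Σ₂ + c₃ * Σ₃ + (g - G 0)) G-top ⟩
  c₂ * Σ₂ + c₃ * Σ₃ + (0ℚ - G 0)
    ≡⟨ cong (λ g → c₂ * Σ₂ + c₃ * Σ₃ + (0ℚ - g)) G-bottom ⟩
  c₂ * Σ₂ + c₃ * Σ₃ + (0ℚ - 0ℚ)
    ≡⟨ ℚP.+-identityʳ (c₂ * Σ₂ + c₃ * Σ₃) ⟩
  c₂ * Σ₂ + c₃ * Σ₃
    ≡⟨ cong₂ (λ x y → c₂ * x + c₃ * y) (Eberlein≡sumUpTo n r (N ℤ.- + 1) (p ℤ.- + 1))
                                       (Eberlein≡sumUpTo n (r ℤ.- + 1) (N ℤ.- + 1) (p ℤ.- + 1)) ⟨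
  c₂ * Eberlein (+ n) r (N ℤ.- + 1) (p ℤ.- + 1)
    + c₃ * Eberlein (+ n) (r ℤ.- + 1) (N ℤ.- + 1) (p ℤ.- + 1) ∎
  where
  c₁ c₂ c₃ Σ₂ Σ₃ : ℚ
  c₁ = ⟦ p ℤ.- + n ⟧ * ⟦ N ℤ.- + 2 ℤ.* r ℤ.+ + 1 ⟧
  c₂ = ⟦ p ℤ.- r ⟧ * ⟦ N ℤ.- r ℤ.+ + 1 ⟧
  c₃ = ⟦ r ⟧ * ⟦ N ℤ.- p ℤ.- r ℤ.+ + 1 ⟧
  Σ₂ = sumUpTo (eberleinTerm r (N ℤ.- + 1) (p ℤ.- + 1) (+ n)) (suc n)
  Σ₃ = sumUpTo (eberleinTerm (r ℤ.- + 1) (N ℤ.- + 1) (p ℤ.- + 1) (+ n)) (suc n)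
  G : ℕ → ℚ
  G = contiguityCertificate r N p (+ n)
  K : ℚ
  K = ⟦ r ⟧ * ⟦ p ℤ.- r ⟧
  G-bottom : G 0 ≡ 0ℚ
  G-bottom = vanish K (binom (p ℤ.- r ℤ.- + 1) (+ n ℤ.- + 0)) (binom (N ℤ.- p ℤ.- r) (+ n ℤ.- + 0))
    where
    vanish : ∀ k b c → k * (1ℚ * 0ℚ * b * c) ≡ 0ℚ
    vanish = solve 3 (λ k b c → k :* (con 1ℚ :* con 0ℚ :* b :* c) := con 0ℚ) refl
  G-top : G (suc n) ≡ 0ℚ
  G-top = trans (cong (λ j → K * (sgn (suc n) * binom (r ℤ.- + 1) (+ n) * binom (p ℤ.- r ℤ.- + 1) j
                                   * binom (N ℤ.- p ℤ.- r) j)) (below (+ suc n)))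
                (vanish K (sgn (suc n)) (binom (r ℤ.- + 1) (+ n)))
    where
    below : ∀ t → t ℤ.- + 1 ℤ.- t ≡ ℤ.- + 1
    below = ℤ-solve-∀
    vanish : ∀ k s a → k * (s * a * 0ℚ * 0ℚ) ≡ 0ℚ
    vanish = solve 3 (λ k s a → k :* (s :* a :* con 0ℚ :* con 0ℚ) := con 0ℚ) refl

-- Coefficients of the Hahn polynomials

hahnNorm : ℤ → ℤ → ℤ → ℚ
hahnNorm x N p = binom p x * binom (N ℤ.- p) x

hahnCoeff : ℤ → ℤ → ℚ
hahnCoeff N r = binom N r - binom N (r ℤ.- + 1)

-- a(a-1)⋯(a-k+1)/(k+1)!; with a = N and r = k + 1 this is the factor γ of the header.
fallOverFact : ℤ → ℕ → ℚ
fallOverFact a k = fall a k * invFact (suc k)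

hahnNorm-pred : ∀ x N p → ⟦ p ⟧ * hahnNorm x (N ℤ.- + 1) (p ℤ.- + 1) ≡ ⟦ p ℤ.- x ⟧ * hahnNorm x N p
hahnNorm-pred x N p = begin
  ⟦ p ⟧ * (binom (p ℤ.- + 1) x * binom (N ℤ.- + 1 ℤ.- (p ℤ.- + 1)) x)
    ≡⟨ cong (λ a → ⟦ p ⟧ * (binom (p ℤ.- + 1) x * binom a x)) (shift N p) ⟩
  ⟦ p ⟧ * (binom (p ℤ.- + 1) x * binom (N ℤ.- p) x)
    ≡⟨ ℚP.*-assoc ⟦ p ⟧ _ _ ⟨
  ⟦ p ⟧ * binom (p ℤ.- + 1) x * binom (N ℤ.- p) x
    ≡⟨ cong (_* binom (N ℤ.- p) x) (binom-pred-upper p x) ⟩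
  ⟦ p ℤ.- x ⟧ * binom p x * binom (N ℤ.- p) x
    ≡⟨ ℚP.*-assoc ⟦ p ℤ.- x ⟧ _ _ ⟩
  ⟦ p ℤ.- x ⟧ * (binom p x * binom (N ℤ.- p) x) ∎
  where
  shift : ∀ N p → N ℤ.- + 1 ℤ.- (p ℤ.- + 1) ≡ N ℤ.- p
  shift = ℤ-solve-∀

hahnCoeff-suc : ∀ N k → hahnCoeff N (+ suc k) ≡ ⟦ N ℤ.- + 2 ℤ.* + suc k ℤ.+ + 1 ⟧ * fallOverFact N k
hahnCoeff-suc N k = begin
  fall N k * X * invFact (suc k) - fall N k * invFact k
    ≡⟨ cong (λ i → fall N k * X * invFact (suc k) - fall N k * i) (invFact-suc k) ⟩
  fall N k * X * invFact (suc k) - fall N k * (⟦ + suc k ⟧ * invFact (suc k))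
    ≡⟨ factor (fall N k) X ⟦ + suc k ⟧ (invFact (suc k)) ⟩
  (X - ⟦ + suc k ⟧) * fallOverFact N k
    ≡⟨ cong (_* fallOverFact N k)
            (trans (cong ⟦_⟧ (shift N (+ suc k))) (⟦⟧-homo-− (N ℤ.- + k) (+ suc k))) ⟨
  ⟦ N ℤ.- + 2 ℤ.* + suc k ℤ.+ + 1 ⟧ * fallOverFact N k ∎
  where
  X : ℚ
  X = ⟦ N ℤ.- + k ⟧
  factor : ∀ f x s i → f * x * i - f * (s * i) ≡ (x - s) * (f * i)
  factor = solve 4 (λ f x s i → f :* x :* i :- f :* (s :* i) := (x :- s) :* (f :* i)) refl
  shift : ∀ N t → N ℤ.- + 2 ℤ.* t ℤ.+ + 1 ≡ N ℤ.- (t ℤ.- + 1) ℤ.- t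
  shift = ℤ-solve-∀

hahnCoeff-pred : ∀ N k → ⟦ N ⟧ * hahnCoeff (N ℤ.- + 1) (+ suc k)
                         ≡ ⟦ N ℤ.- + 1 ℤ.- + 2 ℤ.* + suc k ℤ.+ + 1 ⟧ * (fall N (suc k) * invFact (suc k))
hahnCoeff-pred N k = begin
  ⟦ N ⟧ * hahnCoeff (N ℤ.- + 1) (+ suc k)
    ≡⟨ cong (⟦ N ⟧ *_) (hahnCoeff-suc (N ℤ.- + 1) k) ⟩
  ⟦ N ⟧ * (C * (fall (N ℤ.- + 1) k * invFact (suc k)))
    ≡⟨ swap ⟦ N ⟧ C (fall (N ℤ.- + 1) k) (invFact (suc k)) ⟩
  C * (⟦ N ⟧ * fall (N ℤ.- + 1) k * invFact (suc k))
    ≡⟨ cong (λ f → C * (f * invFact (suc k))) (fall-pred-upper N k) ⟩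
  C * (fall N (suc k) * invFact (suc k)) ∎
  where
  C : ℚ
  C = ⟦ N ℤ.- + 1 ℤ.- + 2 ℤ.* + suc k ℤ.+ + 1 ⟧
  swap : ∀ n c f i → n * (c * (f * i)) ≡ c * (n * f * i)
  swap = solve 4 (λ n c f i → n :* (c :* (f :* i)) := c :* (n :* f :* i)) refl

hahnCoeff-pred-same-degree : ∀ N j → ⟦ N ⟧ * hahnCoeff (N ℤ.- + 1) (+ suc j)
  ≡ ⟦ N ℤ.- + 2 ℤ.* + suc j ⟧ * ⟦ N ℤ.- + suc j ℤ.+ + 1 ⟧ * fallOverFact N j
hahnCoeff-pred-same-degree N j = begin
  ⟦ N ⟧ * hahnCoeff (N ℤ.- + 1) (+ suc j)
    ≡⟨ hahnCoeff-pred N j ⟩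
  ⟦ N ℤ.- + 1 ℤ.- + 2 ℤ.* + suc j ℤ.+ + 1 ⟧ * (fall N j * ⟦ N ℤ.- + j ⟧ * invFact (suc j))
    ≡⟨ cong₂ (λ a b → ⟦ a ⟧ * (fall N j * ⟦ b ⟧ * invFact (suc j)))
             (shift N (+ suc j)) (shift′ N (+ suc j)) ⟩
  ⟦ N ℤ.- + 2 ℤ.* + suc j ⟧ * (fall N j * ⟦ N ℤ.- + suc j ℤ.+ + 1 ⟧ * invFact (suc j))
    ≡⟨ swap ⟦ N ℤ.- + 2 ℤ.* + suc j ⟧ (fall N j) ⟦ N ℤ.- + suc j ℤ.+ + 1 ⟧ (invFact (suc j)) ⟩
  ⟦ N ℤ.- + 2 ℤ.* + suc j ⟧ * ⟦ N ℤ.- + suc j ℤ.+ + 1 ⟧ * fallOverFact N j ∎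
  where
  shift : ∀ N t → N ℤ.- + 1 ℤ.- + 2 ℤ.* t ℤ.+ + 1 ≡ N ℤ.- + 2 ℤ.* t
  shift = ℤ-solve-∀
  shift′ : ∀ N t → N ℤ.- (t ℤ.- + 1) ≡ N ℤ.- t ℤ.+ + 1
  shift′ = ℤ-solve-∀
  swap : ∀ q f x i → q * (f * x * i) ≡ q * x * (f * i)
  swap = solve 4 (λ q f x i → q :* (f :* x :* i) := q :* x :* (f :* i)) refl

hahnCoeff-pred-lower-degree : ∀ N j → ⟦ N ⟧ * hahnCoeff (N ℤ.- + 1) (+ j)
  ≡ ⟦ N ℤ.- + 2 ℤ.* + suc j ℤ.+ + 2 ⟧ * ⟦ + suc j ⟧ * fallOverFact N j
hahnCoeff-pred-lower-degree N zero = begin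
  ⟦ N ⟧ * (1ℚ - 0ℚ)               ≡⟨ unit ⟦ N ⟧ ⟩
  ⟦ N ⟧ * 1ℚ * (1ℚ * 1ℚ)           ≡⟨ cong (λ a → ⟦ a ⟧ * 1ℚ * (1ℚ * 1ℚ)) (shift N) ⟩
  ⟦ N ℤ.- + 2 ℤ.* + 1 ℤ.+ + 2 ⟧ * 1ℚ * (1ℚ * 1ℚ) ∎
  where
  unit : ∀ n → n * (1ℚ - 0ℚ) ≡ n * 1ℚ * (1ℚ * 1ℚ)
  unit = solve 1 (λ n → n :* (con 1ℚ :- con 0ℚ) := n :* con 1ℚ :* (con 1ℚ :* con 1ℚ)) refl
  shift : ∀ N → N ≡ N ℤ.- + 2 ℤ.* + 1 ℤ.+ + 2
  shift = ℤ-solve-∀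
hahnCoeff-pred-lower-degree N (suc i) = begin
  ⟦ N ⟧ * hahnCoeff (N ℤ.- + 1) (+ suc i)
    ≡⟨ hahnCoeff-pred N i ⟩
  ⟦ N ℤ.- + 1 ℤ.- + 2 ℤ.* + suc i ℤ.+ + 1 ⟧ * (fall N (suc i) * invFact (suc i))
    ≡⟨ cong₂ (λ a f → ⟦ a ⟧ * (fall N (suc i) * f)) (shift N (+ suc (suc i))) (invFact-suc (suc i)) ⟩
  Q₂ * (fall N (suc i) * (⟦ + suc (suc i) ⟧ * invFact (suc (suc i))))
    ≡⟨ swap Q₂ (fall N (suc i)) ⟦ + suc (suc i) ⟧ (invFact (suc (suc i))) ⟩
  Q₂ * ⟦ + suc (suc i) ⟧ * fallOverFact N (suc i) ∎
  where
  Q₂ : ℚ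
  Q₂ = ⟦ N ℤ.- + 2 ℤ.* + suc (suc i) ℤ.+ + 2 ⟧
  shift : ∀ N t → N ℤ.- + 1 ℤ.- + 2 ℤ.* (t ℤ.- + 1) ℤ.+ + 1 ≡ N ℤ.- + 2 ℤ.* t ℤ.+ + 2
  shift = ℤ-solve-∀
  swap : ∀ q f s i → q * (f * (s * i)) ≡ q * s * (f * i)
  swap = solve 4 (λ q f s i → q :* (f :* (s :* i)) := q :* s :* (f :* i)) refl

-- Assembling the recurrence

recurrence-from-contiguity : ∀ {Ñ Q Q₂ π γ C₁ C₂ R c d Δ Δ′ Δ″ E E′ E″ iP iB iQ iQ₂ iA : ℚ} →
  Q * iQ ≡ 1ℚ → Q₂ * iQ₂ ≡ 1ℚ → iA ≡ iP * iB * π →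
  Δ ≡ C₁ * γ → Ñ * Δ′ ≡ Q * C₂ * γ → Ñ * Δ″ ≡ Q₂ * R * γ →
  π * C₁ * E ≡ c * C₂ * E′ + R * d * E″ →
  Δ * iA * E ≡ Ñ * iP * (c * iQ * (Δ′ * iB * E′) + d * iQ₂ * (Δ″ * iB * E″))
recurrence-from-contiguity {Ñ} {Q} {Q₂} {π} {γ} {C₁} {C₂} {R} {c} {d} {_} {Δ′} {Δ″} {E} {E′} {E″}
                   {iP} {iB} {iQ} {iQ₂} QiQ≡1 Q₂iQ₂≡1 refl refl Δ′-eq Δ″-eq contiguity = begin
  C₁ * γ * (iP * iB * π) * E
    ≡⟨ solve 6 (λ C₁ γ iP iB π E → C₁ :* γ :* (iP :* iB :* π) :* E := iP :* iB :* γ :* (π :* C₁ :* E))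
               refl C₁ γ iP iB π E ⟩
  iP * iB * γ * (π * C₁ * E)
    ≡⟨ cong (iP * iB * γ *_) contiguity ⟩
  iP * iB * γ * (c * C₂ * E′ + R * d * E″)
    ≡⟨ solve 9 (λ iP iB γ c C₂ E′ R d E″ → iP :* iB :* γ :* (c :* C₂ :* E′ :+ R :* d :* E″)
                 := iP :* iB :* γ :* (c :* C₂ :* con 1ℚ :* E′ :+ R :* d :* con 1ℚ :* E″))
               refl iP iB γ c C₂ E′ R d E″ ⟩
  iP * iB * γ * (c * C₂ * 1ℚ * E′ + R * d * 1ℚ * E″)
    ≡⟨ cong₂ (λ x y → iP * iB * γ * (c * C₂ * x * E′ + R * d * y * E″)) QiQ≡1 Q₂iQ₂≡1 ⟨
  iP * iB * γ * (c * C₂ * (Q * iQ) * E′ + R * d * (Q₂ * iQ₂) * E″)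
    ≡⟨ solve 13 (λ iP iB γ c C₂ Q iQ E′ R d Q₂ iQ₂ E″ →
                 iP :* iB :* γ :* (c :* C₂ :* (Q :* iQ) :* E′ :+ R :* d :* (Q₂ :* iQ₂) :* E″)
                 := iP :* iB :* (c :* iQ :* (Q :* C₂ :* γ) :* E′ :+ d :* iQ₂ :* (Q₂ :* R :* γ) :* E″))
               refl iP iB γ c C₂ Q iQ E′ R d Q₂ iQ₂ E″ ⟩
  iP * iB * (c * iQ * (Q * C₂ * γ) * E′ + d * iQ₂ * (Q₂ * R * γ) * E″)
    ≡⟨ cong₂ (λ x y → iP * iB * (c * iQ * x * E′ + d * iQ₂ * y * E″)) Δ′-eq Δ″-eq ⟨
  iP * iB * (c * iQ * (Ñ * Δ′) * E′ + d * iQ₂ * (Ñ * Δ″) * E″)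
    ≡⟨ solve 11 (λ iP iB c iQ Ñ Δ′ E′ d iQ₂ Δ″ E″ →
                 iP :* iB :* (c :* iQ :* (Ñ :* Δ′) :* E′ :+ d :* iQ₂ :* (Ñ :* Δ″) :* E″)
                 := Ñ :* iP :* (c :* iQ :* (Δ′ :* iB :* E′) :+ d :* iQ₂ :* (Δ″ :* iB :* E″)))
               refl iP iB c iQ Ñ Δ′ E′ d iQ₂ Δ″ E″ ⟩
  Ñ * iP * (c * iQ * (Δ′ * iB * E′) + d * iQ₂ * (Δ″ * iB * E″)) ∎

Hahn-negative-degree : ∀ k x N p → Hahn -[1+ k ] x N p ≡ 0ℚ
Hahn-negative-degree k x N p = vanish (inv (hahnNorm x N p)) (Eberlein x -[1+ k ] N p)
  where
  vanish : ∀ i e → (0ℚ - 0ℚ) * i * e ≡ 0ℚ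
  vanish = solve 2 (λ i e → (con 0ℚ :- con 0ℚ) :* i :* e := con 0ℚ) refl

Hahn-degree-zero : ∀ n N p → hahnNorm (+ n) N p ≢ 0ℚ → Hahn (+ 0) (+ n) N p ≡ 1ℚ
Hahn-degree-zero n N p A≢0 = begin
  (1ℚ - 0ℚ) * inv A * Eberlein (+ n) (+ 0) N p
    ≡⟨ cong ((1ℚ - 0ℚ) * inv A *_) (Eberlein-at-zero n N p) ⟩
  (1ℚ - 0ℚ) * inv A * A
    ≡⟨ swap A (inv A) ⟩
  A * inv A
    ≡⟨ inv-inverseʳ A≢0 ⟩
  1ℚ ∎
  where
  A : ℚ
  A = hahnNorm (+ n) N p
  swap : ∀ a i → (1ℚ - 0ℚ) * i * a ≡ a * i
  swap = solve 2 (λ a i → (con 1ℚ :- con 0ℚ) :* i :* a := a :* i) refl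

vanishing-combination : ∀ {a b c x y} → x ≡ 0ℚ → y ≡ 0ℚ → a * (b * x + c * y) ≡ 0ℚ
vanishing-combination {a} {b} {c} refl refl =
  solve 3 (λ a b c → a :* (b :* con 0ℚ :+ c :* con 0ℚ) := con 0ℚ) refl a b c

unit-combination : ∀ {a b c q d x y} → a ≢ 0ℚ → b ≢ 0ℚ → c ≡ b → q ≡ a → x ≡ 1ℚ → y ≡ 0ℚ →
                   a * inv b * (c * inv q * x + d * y) ≡ 1ℚ
unit-combination {a} {b} {d = d} a≢0 b≢0 refl refl refl refl = begin
  a * inv b * (b * inv a * 1ℚ + d * 0ℚ)
    ≡⟨ solve 5 (λ a b i j d → a :* j :* (b :* i :* con 1ℚ :+ d :* con 0ℚ) := a :* i :* (b :* j))
             refl a b (inv a) (inv b) d ⟩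
  a * inv a * (b * inv b)
    ≡⟨ cong₂ _*_ (inv-inverseʳ a≢0) (inv-inverseʳ b≢0) ⟩
  1ℚ ∎

mainTheorem2 : (N p r x : ℤ) →
    ⟦ p ⟧ ≢ 0ℚ →
    ⟦ N ℤ.- + 2 ℤ.* r ⟧ ≢ 0ℚ →
    ⟦ N ℤ.- + 2 ℤ.* r ℤ.+ + 2 ⟧ ≢ 0ℚ →
    binom p x * binom (N ℤ.- p) x ≢ 0ℚ →
    binom (p ℤ.- + 1) x * binom ((N ℤ.- + 1) ℤ.- (p ℤ.- + 1)) x ≢ 0ℚ →
    Hahn r x N p ≡
      (⟦ N ⟧ ÷ ⟦ p ⟧) *
        ((⟦ p ℤ.- r ⟧ ÷ ⟦ N ℤ.- + 2 ℤ.* r ⟧) * Hahn r x (N ℤ.- + 1) (p ℤ.- + 1)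
         + (⟦ N ℤ.- p ℤ.- r ℤ.+ + 1 ⟧ ÷ ⟦ N ℤ.- + 2 ℤ.* r ℤ.+ + 2 ⟧)
             * Hahn (r ℤ.- + 1) x (N ℤ.- + 1) (p ℤ.- + 1))
mainTheorem2 N p r -[1+ k ] _ _ _ A≢0 _ = ⊥-elim (A≢0 (ℚP.*-zeroʳ (binom p -[1+ k ])))
mainTheorem2 N p r@(-[1+ k ]) x _ _ _ _ _ =
  trans (Hahn-negative-degree k x N p) (sym (vanishing-combination {a = ⟦ N ⟧ ÷ ⟦ p ⟧}
    {b = ⟦ p ℤ.- r ⟧ ÷ ⟦ N ℤ.- + 2 ℤ.* r ⟧} {c = ⟦ N ℤ.- p ℤ.- r ℤ.+ + 1 ⟧ ÷ ⟦ N ℤ.- + 2 ℤ.* r ℤ.+ + 2 ⟧}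
    (Hahn-negative-degree k x (N ℤ.- + 1) (p ℤ.- + 1))
    (Hahn-negative-degree (suc (k ℕ.+ 0)) x (N ℤ.- + 1) (p ℤ.- + 1))))
mainTheorem2 N p (+ zero) (+ n) p≢0 N≢0 _ A≢0 B≢0 =
  trans (Hahn-degree-zero n N p A≢0) (sym (unit-combination
    {d = ⟦ N ℤ.- p ℤ.- + 0 ℤ.+ + 1 ⟧ ÷ ⟦ N ℤ.- + 2 ℤ.* + 0 ℤ.+ + 2 ⟧}
    (subst (λ z → ⟦ z ⟧ ≢ 0ℚ) (N-2·0≡N N) N≢0) p≢0
    (cong ⟦_⟧ (ℤP.+-identityʳ p)) (cong ⟦_⟧ (N-2·0≡N N))
    (Hahn-degree-zero n (N ℤ.- + 1) (p ℤ.- + 1) B≢0)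
    (Hahn-negative-degree 0 (+ n) (N ℤ.- + 1) (p ℤ.- + 1))))
  where
  N-2·0≡N : ∀ N → N ℤ.- + 2 ℤ.* + 0 ≡ N
  N-2·0≡N = ℤ-solve-∀
mainTheorem2 N p r@(+ suc j) (+ n) p≢0 Q≢0 Q₂≢0 A≢0 B≢0 =
  recurrence-from-contiguity {Ñ = ⟦ N ⟧} {Q = ⟦ N ℤ.- + 2 ℤ.* r ⟧} {Q₂ = ⟦ N ℤ.- + 2 ℤ.* r ℤ.+ + 2 ⟧}
    {π = ⟦ p ℤ.- + n ⟧} {γ = fallOverFact N j} {C₁ = ⟦ N ℤ.- + 2 ℤ.* r ℤ.+ + 1 ⟧}
    {C₂ = ⟦ N ℤ.- r ℤ.+ + 1 ⟧} {R = ⟦ r ⟧} {c = ⟦ p ℤ.- r ⟧} {d = ⟦ N ℤ.- p ℤ.- r ℤ.+ + 1 ⟧}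
    (inv-inverseʳ Q≢0) (inv-inverseʳ Q₂≢0)
    (inv-cross p≢0 B≢0 A≢0 (hahnNorm-pred (+ n) N p))
    (hahnCoeff-suc N j) (hahnCoeff-pred-same-degree N j) (hahnCoeff-pred-lower-degree N j)
    (Eberlein-contiguity n r N p)
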